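{- Let $a,b,c\in{\mathbb L}$ be three pairwise distinct elements. Then the structure $(\{0,1\};\mathrm{NAE})$, where $\mathrm{NAE}=\{0,1\}^3\setminus\{(0,0,0),(1,1,1)\}$, has a primitive positive interpretation in the structure $({\mathbb L};Q_d,a,b,c)$ (the expansion of $({\mathbb L};Q_d)$ by the three constants $a,b,c$).
   Context: Let $({\mathbb L};C)$ denote the homogeneous binary branching C-relation: ${\mathbb L}$ is a countably infinite set and $({\mathbb L};C)$ is the (up to isomorphism unique) countable homogeneous structure whose finite substructures are, up to isomorphism, exactly the structures $(L;C^T)$ where $T$ is a finite rooted binary tree (every inner vertex has exactly two children) with leaf set $L$, and $C^T(x,y,z)$ holds iff the youngest common ancestor of $y$ and $z$ is a proper descendant of the youngest common ancestor of $x,y,z$. One writes $x|yz$ and also $yz|x$ for $C(x,y,z)$. The quaternary (quartet) relation $Q_d$ on ${\mathbb L}$ is defined by: $Q_d(x,y,z,t)$ holds iff $x,y,z,t$ are pairwise distinct and $(xy|z \wedge xy|t)\vee(zt|x\wedge zt|y)$. A relational $\sigma$-structure $\Delta$ has a primitive positive interpretation in a $\tau$-structure $\Gamma$ if there exist a natural number $d$, a primitive positive $\tau$-formula $\delta(x_1,\dots,x_d)$ (domain formula), for each atomic $\sigma$-formula $\phi(y_1,\dots,y_k)$ (including equality) a primitive positive $\tau$-formula $\phi_I(\bar x_1,\dots,\bar x_k)$ where the $\bar x_i$ are disjoint $d$-tuples of distinct variables, and a surjective map $h$ from the set of $d$-tuples of elements of $\Gamma$ satisfying $\delta$ onto the domain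 of $\Delta$, such that for all atomic $\sigma$-formulas $\phi$ and all tuples $\bar a_1,\dots,\bar a_k$ in the domain of $h$: $\Delta\models\phi(h(\bar a_1),\dots,h(\bar a_k))$ iff $\Gamma\models\phi_I(\bar a_1,\dots,\bar a_k)$. In an expansion by constants, the constants may be used in these formulas. -}

module Defs where

open import Data.Nat using (ℕ; zero; suc; _<_; _+_)
open import Data.Fin using (Fin; zero; suc)
open import Data.Bool using (Bool; true; false)
open import Data.Product using (Σ; ∃; _×_; _,_)
open import Data.Sum using (_⊎_; inj₁; inj₂; [_,_])
open import Data.List using (List)
open import Data.List.Relation.Unary.All using (All)
open import Relation.Nullary using (¬_)
open import Relation.Binary.PropositionalEquality using (_≡_; _≢_)
open import Function using (_⇔_; _↔_; Inverse)

data BTree : Set where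
  leaf : BTree
  node : BTree → BTree → BTree

data Leaf : BTree → Set where
  here  : Leaf leaf
  left  : ∀ {l r} → Leaf l → Leaf (node l r)
  right : ∀ {l r} → Leaf r → Leaf (node l r)

-- Depth of the youngest common ancestor of two leaves.
yca₂ : ∀ {T} → Leaf T → Leaf T → ℕ
yca₂ here      here      = zero
yca₂ (left p)  (left q)  = suc (yca₂ p q)
yca₂ (right p) (right q) = suc (yca₂ p q)
yca₂ (left p)  (right q) = zero
yca₂ (right p) (left q)  = zero

yca₃ : ∀ {T} → Leaf T → Leaf T → Leaf T → ℕ
yca₃ here      here      here      = zero
yca₃ (left p)  (left q)  (left r)  = suc (yca₃ p q r)
yca₃ (right p) (right q) (right r) = suc (yca₃ p q r)
yca₃ (left p)  (left q)  (right r) = zero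
yca₃ (left p)  (right q) _         = zero
yca₃ (right p) (right q) (left r)  = zero
yca₃ (right p) (left q)  _         = zero

-- C^T(x,y,z): yca(y,z) is a proper descendant of yca(x,y,z).  Both vertices
-- lie on the root-to-y path, so "proper descendant" = strictly greater depth.
CT : ∀ {T} → Leaf T → Leaf T → Leaf T → Set
CT x y z = yca₃ x y z < yca₂ y z

-- The homogeneous binary branching C-relation (characterised as the
-- countable homogeneous structure with the prescribed age).

record IsHomBinBranchC (L : Set) (C : L → L → L → Set) : Set₁ where
  field
    countable : ℕ ↔ L
    homogeneous : ∀ n (f g : Fin n → L) →
      (∀ i j → f i ≡ f j → i ≡ j) → (∀ i j → g i ≡ g j → i ≡ j) →
      (∀ i j k → C (f i) (f j) (f k) ⇔ C (g i) (g j) (g k)) →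
      Σ (L ↔ L) λ σ →
        (∀ x y z → C x y z ⇔ C (Inverse.to σ x) (Inverse.to σ y) (Inverse.to σ z))
        × (∀ i → Inverse.to σ (f i) ≡ g i)
    age-⊆ : ∀ n (f : Fin (suc n) → L) → (∀ i j → f i ≡ f j → i ≡ j) →
      Σ BTree λ T → Σ (Fin (suc n) ↔ Leaf T) λ β →
        ∀ i j k → C (f i) (f j) (f k) ⇔ CT (Inverse.to β i) (Inverse.to β j) (Inverse.to β k)
    age-⊇ : ∀ (T : BTree) → Σ (Leaf T → L) λ e →
      (∀ x y → e x ≡ e y → x ≡ y) ×
      (∀ x y z → CT x y z ⇔ C (e x) (e y) (e z))

-- x y | z  is written  C z x y.
Qd : ∀ {L : Set} → (L → L → L → Set) → L → L → L → L → Set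
Qd C x y z t =
  (x ≢ y × x ≢ z × x ≢ t × y ≢ z × y ≢ t × z ≢ t) ×
  ((C z x y × C t x y) ⊎ (C x z t × C y z t))

NAE : Bool → Bool → Bool → Set
NAE x y z = ¬ (x ≡ false × y ≡ false × z ≡ false) × ¬ (x ≡ true × y ≡ true × z ≡ true)

module PP (L : Set) (Q : L → L → L → L → Set) {k : ℕ} (cst : Fin k → L) where

  data Term (V : Set) : Set where
    var : V → Term V
    con : Fin k → Term V

  data Atom (V : Set) : Set where
    Qa  : Term V → Term V → Term V → Term V → Atom V
    Eqa : Term V → Term V → Atom V

  -- ∃ y₁…yₘ. (conjunction of atoms), free variables from V
  record Formula (V : Set) : Set where
    constructor ppf
    field
      nbound : ℕ
      atoms  : List (Atom (V ⊎ Fin nbound))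

  evalT : ∀ {V} → (V → L) → Term V → L
  evalT ρ (var v) = ρ v
  evalT ρ (con i) = cst i

  holdsA : ∀ {V} → (V → L) → Atom V → Set
  holdsA ρ (Qa s t u w) = Q (evalT ρ s) (evalT ρ t) (evalT ρ u) (evalT ρ w)
  holdsA ρ (Eqa s t)    = evalT ρ s ≡ evalT ρ t

  Sat : ∀ {V} → Formula V → (V → L) → Set
  Sat (ppf m as) ρ = Σ (Fin m → L) λ w → All (holdsA [ ρ , w ]) as

  -- A primitive positive interpretation of (B; R), R ternary, in (L; Q, cst).
  -- The i-th argument tuple of a k-ary formula uses the variables (i , _).
  record PPInterpretation (B : Set) (R : B → B → B → Set) : Set₁ where
    field
      d     : ℕ
      δ     : Formula (Fin d)
      φR    : Formula (Fin 3 × Fin d)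
      φEq   : Formula (Fin 2 × Fin d)
      h     : (Fin d → L) → B
      h-surj : ∀ (v : B) → Σ (Fin d → L) λ a → Sat δ a × h a ≡ v
      R-ok  : ∀ (a : Fin 3 → Fin d → L) → (∀ i → Sat δ (a i)) →
              R (h (a zero)) (h (a (suc zero))) (h (a (suc (suc zero))))
                ⇔ Sat φR (λ { (i , j) → a i j })
      Eq-ok : ∀ (a : Fin 2 → Fin d → L) → (∀ i → Sat δ (a i)) →
              (h (a zero) ≡ h (a (suc zero))) ⇔ Sat φEq (λ { (i , j) → a i j })

consts3 : ∀ {L : Set} → L → L → L → Fin 3 → L
consts3 a b c zero = a
consts3 a b c (suc zero) = b
consts3 a b c (suc (suc zero)) = c

-- Every finite subset of 𝕃 is the leaf set of a finite binary tree, and C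
-- (hence Q_d) is read off from the depths of youngest common ancestors. In
-- this "meet depth" language Q_d obeys the quartet axioms: symmetries,
-- exclusivity, trichotomy, splitting and transitivity. Homogeneity gives the
-- one-point extension property, hence for every p and finite set F a fresh
-- twin p′ with p p′ | y z for all y, z ∈ F, which replaces p in every quartet
-- over F; all existential witnesses of the interpretation are such twins.
--
-- The interpretation is one-dimensional. Its domain is {x : xa|bc or xb|ac},
-- defined by ∃u₀u₁. au₁|bu₀ ∧ ax|cu₀ ∧ bx|cu₁, and x ↦ true iff xa|bc.
-- Equality of values is ∃u. bc|ux ∧ ac|uy, and NAE(x,y,z) is the conjunction
-- of "not all of x, y, z are near b" and its mirror image with a and b
-- exchanged, each expressed with two auxiliary points.

module Submission where

open import Defs
open import Data.Bool using (Bool; true; false)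
open import Data.Empty using (⊥-elim)
open import Data.Fin as Fin using (Fin; zero; suc; #_)
open import Data.List using (List; []; _∷_; length; lookup; deduplicate)
open import Data.List.Membership.Propositional using (_∈_)
open import Data.List.Membership.Propositional.Properties using (∈-lookup; ∈-deduplicate⁺)
open import Data.List.Relation.Unary.All as All using (All; []; _∷_)
open import Data.List.Relation.Unary.AllPairs.Core using ([]; _∷_)
open import Data.List.Relation.Unary.Any using (here; there; index)
open import Data.List.Relation.Unary.Any.Properties using (lookup-index)
open import Data.List.Relation.Unary.Unique.Propositional using (Unique)
import Data.List.Relation.Unary.Unique.DecPropositional.Properties as UniqueDec
open import Data.Nat as ℕ using (ℕ; zero; suc; _<_; _≤_; _⊓_; z≤n; s≤s; _<?_)
open import Data.Nat.Properties
  using (≤-refl; ≤-antisym; <-irrefl; <-asym; <-trans; <⇒≤; <⇒≱; ≮⇒≥;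
         ≤-<-trans; <-≤-trans; <-cmp; suc-injective; ⊓-zeroʳ; ⊓-sel; m⊓n≤m; m≤n⇒m⊓n≡m)
open import Data.Product using (Σ; ∃; ∃₂; _×_; _,_; proj₁; proj₂)
open import Data.Product.Function.NonDependent.Propositional using (_×-⇔_)
open import Data.Sum as Sum using (_⊎_; inj₁; inj₂; [_,_])
open import Data.Sum.Function.Propositional using (_⊎-⇔_)
open import Data.Vec.Functional using () renaming (_∷_ to _◂_)
open import Function using (_⇔_; mk⇔; Equivalence; _↔_; Inverse; _∘_; _∘′_; id)
open import Function.Bundles using (Injection)
open import Function.Construct.Composition using (_⇔-∘_)
open import Function.Construct.Identity using (⇔-id)
open import Function.Construct.Symmetry using (⇔-sym; ↔-sym)
open import Function.Properties.Inverse using (↔⇒↣)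
open import Function.Related.TypeIsomorphisms using (¬-cong-⇔)
open import Relation.Binary.Definitions using (DecidableEquality; tri<; tri≈; tri>)
open import Relation.Binary.PropositionalEquality hiding ([_])
open import Relation.Nullary using (Dec; yes; no; does; ¬_; contradiction)
open import Relation.Nullary.Decidable
  using (True; toWitness; map; map′; via-injection; dec-true; dec-false; _×-dec_; _⊎-dec_; ¬?)

-- Meet depths in finite binary trees

left-injective : ∀ {l r} {p q : Leaf l} → left {r = r} p ≡ left q → p ≡ q
left-injective refl = refl

right-injective : ∀ {l r} {p q : Leaf r} → right {l = l} p ≡ right q → p ≡ q
right-injective refl = refl

_≟ᴸ_ : ∀ {T} → DecidableEquality (Leaf T)
here    ≟ᴸ here    = yes refl
left p  ≟ᴸ left q  = map′ (cong left) left-injective (p ≟ᴸ q)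
left p  ≟ᴸ right q = no λ ()
right p ≟ᴸ left q  = no λ ()
right p ≟ᴸ right q = map′ (cong right) right-injective (p ≟ᴸ q)

yca₂-sym : ∀ {T} (p q : Leaf T) → yca₂ p q ≡ yca₂ q p
yca₂-sym here      here      = refl
yca₂-sym (left p)  (left q)  = cong suc (yca₂-sym p q)
yca₂-sym (left p)  (right q) = refl
yca₂-sym (right p) (left q)  = refl
yca₂-sym (right p) (right q) = cong suc (yca₂-sym p q)

yca₃≡yca₂⊓yca₂ : ∀ {T} (p q r : Leaf T) → yca₃ p q r ≡ yca₂ p q ⊓ yca₂ q r
yca₃≡yca₂⊓yca₂ here      here      here      = refl
yca₃≡yca₂⊓yca₂ (left p)  (left q)  (left r)  = cong suc (yca₃≡yca₂⊓yca₂ p q r)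
yca₃≡yca₂⊓yca₂ (left p)  (left q)  (right r) = sym (⊓-zeroʳ (suc (yca₂ p q)))
yca₃≡yca₂⊓yca₂ (left p)  (right q) (left r)  = refl
yca₃≡yca₂⊓yca₂ (left p)  (right q) (right r) = refl
yca₃≡yca₂⊓yca₂ (right p) (left q)  (left r)  = refl
yca₃≡yca₂⊓yca₂ (right p) (left q)  (right r) = refl
yca₃≡yca₂⊓yca₂ (right p) (right q) (left r)  = sym (⊓-zeroʳ (suc (yca₂ p q)))
yca₃≡yca₂⊓yca₂ (right p) (right q) (right r) = cong suc (yca₃≡yca₂⊓yca₂ p q r)

yca₃≤yca₂ : ∀ {T} (p q r : Leaf T) → yca₃ p q r ≤ yca₂ p r
yca₃≤yca₂ here      here      here      = ≤-refl
yca₃≤yca₂ (left p)  (left q)  (left r)  = s≤s (yca₃≤yca₂ p q r)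
yca₃≤yca₂ (right p) (right q) (right r) = s≤s (yca₃≤yca₂ p q r)
yca₃≤yca₂ (left p)  (left q)  (right r) = z≤n
yca₃≤yca₂ (left p)  (right q) _         = z≤n
yca₃≤yca₂ (right p) (right q) (left r)  = z≤n
yca₃≤yca₂ (right p) (left q)  _         = z≤n

yca₂-ultrametric : ∀ {T} (p q r : Leaf T) → yca₂ p q ⊓ yca₂ q r ≤ yca₂ p r
yca₂-ultrametric p q r = subst (_≤ yca₂ p r) (yca₃≡yca₂⊓yca₂ p q r) (yca₃≤yca₂ p q r)

yca₂-binary : ∀ {T} (p q r : Leaf T) → q ≢ r → yca₂ p q ≡ yca₂ p r → yca₂ p q < yca₂ q r
yca₂-binary here      here      here      q≢r _ = contradiction refl q≢r
yca₂-binary (left p)  (left q)  (left r)  q≢r e =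
  s≤s (yca₂-binary p q r (q≢r ∘′ cong left) (suc-injective e))
yca₂-binary (right p) (right q) (right r) q≢r e =
  s≤s (yca₂-binary p q r (q≢r ∘′ cong right) (suc-injective e))
yca₂-binary (left p)  (right q) (right r) _ _ = s≤s z≤n
yca₂-binary (right p) (left q)  (left r)  _ _ = s≤s z≤n
yca₂-binary (left p)  (left q)  (right r) _ ()
yca₂-binary (left p)  (right q) (left r)  _ ()
yca₂-binary (right p) (left q)  (right r) _ ()
yca₂-binary (right p) (right q) (left r)  _ ()

yca₂≤yca₂-diag : ∀ {T} (p q : Leaf T) → yca₂ p q ≤ yca₂ p p
yca₂≤yca₂-diag here      here      = ≤-refl
yca₂≤yca₂-diag (left p)  (left q)  = s≤s (yca₂≤yca₂-diag p q)
yca₂≤yca₂-diag (left p)  (right q) = z≤n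
yca₂≤yca₂-diag (right p) (left q)  = z≤n
yca₂≤yca₂-diag (right p) (right q) = s≤s (yca₂≤yca₂-diag p q)

yca₂<yca₂-diag : ∀ {T} (p q : Leaf T) → p ≢ q → yca₂ p q < yca₂ p p
yca₂<yca₂-diag here      here      p≢q = contradiction refl p≢q
yca₂<yca₂-diag (left p)  (left q)  p≢q = s≤s (yca₂<yca₂-diag p q (p≢q ∘′ cong left))
yca₂<yca₂-diag (left p)  (right q) _   = s≤s z≤n
yca₂<yca₂-diag (right p) (left q)  _   = s≤s z≤n
yca₂<yca₂-diag (right p) (right q) p≢q = s≤s (yca₂<yca₂-diag p q (p≢q ∘′ cong right))

m⊓n<n⇔m<n : ∀ m n → m ⊓ n < n ⇔ m < n
m⊓n<n⇔m<n m n = mk⇔ to (≤-<-trans (m⊓n≤m m n))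
  where
  to : m ⊓ n < n → m < n
  to m⊓n<n with ⊓-sel m n
  ... | inj₁ m⊓n≡m = subst (_< n) m⊓n≡m m⊓n<n
  ... | inj₂ m⊓n≡n = contradiction (subst (_< n) m⊓n≡n m⊓n<n) (<-irrefl refl)

CT⇔yca₂< : ∀ {T} (x y z : Leaf T) → CT x y z ⇔ yca₂ x y < yca₂ y z
CT⇔yca₂< x y z rewrite yca₃≡yca₂⊓yca₂ x y z = m⊓n<n⇔m<n (yca₂ x y) (yca₂ y z)

-- On a degenerate triple the truth value of C^T is fixed by the diagonal, so
-- preserving yca₂ on distinct pairs suffices.
CT-preserved : ∀ {T T'} (h : Leaf T → Leaf T') → (∀ {x y} → h x ≡ h y → x ≡ y) →
               (∀ {x y} → x ≢ y → yca₂ (h x) (h y) ≡ yca₂ x y) →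
               ∀ x y z → CT (h x) (h y) (h z) ⇔ CT x y z
CT-preserved h h-injective h-yca₂ x y z =
  ⇔-sym (CT⇔yca₂< x y z) ⇔-∘ (yca₂<-preserved ⇔-∘ CT⇔yca₂< (h x) (h y) (h z))
  where
  yca₂<-preserved : yca₂ (h x) (h y) < yca₂ (h y) (h z) ⇔ yca₂ x y < yca₂ y z
  yca₂<-preserved with x ≟ᴸ y | y ≟ᴸ z
  ... | yes refl | _ = mk⇔ (λ p → contradiction (yca₂≤yca₂-diag (h x) (h z)) (<⇒≱ p))
                          (λ p → contradiction (yca₂≤yca₂-diag x z) (<⇒≱ p))
  ... | no x≢y | yes refl =
    mk⇔ (λ _ → subst (_< yca₂ y y) (yca₂-sym y x) (yca₂<yca₂-diag y x (x≢y ∘′ sym)))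
        (λ _ → subst (_< yca₂ (h y) (h y)) (yca₂-sym (h y) (h x))
                 (yca₂<yca₂-diag (h y) (h x) (x≢y ∘′ sym ∘′ h-injective)))
  ... | no x≢y | no y≢z rewrite h-yca₂ x≢y | h-yca₂ y≢z = mk⇔ (λ p → p) (λ p → p)

-- graft p: the leaf p becomes an inner vertex with the children old p p and new p.
graft : ∀ {T} → Leaf T → BTree
graft {leaf}     here      = node leaf leaf
graft {node l r} (left p)  = node (graft p) r
graft {node l r} (right p) = node l (graft p)

old : ∀ {T} (p : Leaf T) → Leaf T → Leaf (graft p)
old here      here      = left here
old (left p)  (left q)  = left (old p q)
old (left p)  (right q) = right q
old (right p) (left q)  = left q
old (right p) (right q) = right (old p q)

new : ∀ {T} (p : Leaf T) → Leaf (graft p)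
new here      = right here
new (left p)  = left (new p)
new (right p) = right (new p)

old-injective : ∀ {T} (p : Leaf T) {x y : Leaf T} → old p x ≡ old p y → x ≡ y
old-injective here      {here}    {here}    _ = refl
old-injective (left p)  {left x}  {left y}  e = cong left (old-injective p (left-injective e))
old-injective (left p)  {right x} {right y} refl = refl
old-injective (right p) {left x}  {left y}  refl = refl
old-injective (right p) {right x} {right y} e = cong right (old-injective p (right-injective e))

new≢old : ∀ {T} (p x : Leaf T) → new p ≢ old p x
new≢old here      here      ()
new≢old (left p)  (left x)  e = new≢old p x (left-injective e)
new≢old (right p) (right x) e = new≢old p x (right-injective e)

yca₂-old : ∀ {T} (p : Leaf T) {x y : Leaf T} → x ≢ y → yca₂ (old p x) (old p y) ≡ yca₂ x y
yca₂-old here      {here}    {here}    x≢y = contradiction refl x≢y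
yca₂-old (left p)  {left x}  {left y}  x≢y = cong suc (yca₂-old p (x≢y ∘′ cong left))
yca₂-old (left p)  {left x}  {right y} _   = refl
yca₂-old (left p)  {right x} {left y}  _   = refl
yca₂-old (left p)  {right x} {right y} _   = refl
yca₂-old (right p) {left x}  {left y}  _   = refl
yca₂-old (right p) {left x}  {right y} _   = refl
yca₂-old (right p) {right x} {left y}  _   = refl
yca₂-old (right p) {right x} {right y} x≢y = cong suc (yca₂-old p (x≢y ∘′ cong right))

yca₂-new-old : ∀ {T} (p x : Leaf T) → x ≢ p → yca₂ (new p) (old p x) ≡ yca₂ p x
yca₂-new-old here      here      x≢p = contradiction refl x≢p
yca₂-new-old (left p)  (left x)  x≢p = cong suc (yca₂-new-old p x (x≢p ∘′ cong left))
yca₂-new-old (left p)  (right x) _   = refl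
yca₂-new-old (right p) (left x)  _   = refl
yca₂-new-old (right p) (right x) x≢p = cong suc (yca₂-new-old p x (x≢p ∘′ cong right))

yca₂-old-new : ∀ {T} (p : Leaf T) → yca₂ (old p p) (new p) ≡ yca₂ p p
yca₂-old-new here      = refl
yca₂-old-new (left p)  = cong suc (yca₂-old-new p)
yca₂-old-new (right p) = cong suc (yca₂-old-new p)

yca₂-old<yca₂-old-new : ∀ {T} (p x : Leaf T) → x ≢ p →
                        yca₂ (old p x) (old p p) < yca₂ (old p p) (new p)
yca₂-old<yca₂-old-new p x x≢p =
  subst₂ _<_ (sym (yca₂-old p x≢p)) (sym (yca₂-old-new p))
    (subst (_< yca₂ p p) (yca₂-sym p x) (yca₂<yca₂-diag p x (x≢p ∘′ sym)))

-- Quartets of a branching ultrametric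

-- With d u v the depth of the youngest common ancestor, C(u,v,w) reads
-- d u v < d v w; so Quartet d x y z t is the quartet xy|zt of Q_d.
data Quartet {I : Set} (d : I → I → ℕ) (x y z t : I) : Set where
  cherryˡ : d z x < d x y → d t x < d x y → Quartet d x y z t
  cherryʳ : d x z < d z t → d y z < d z t → Quartet d x y z t

Quartet⇔⊎ : ∀ {I : Set} {d : I → I → ℕ} {x y z t} →
            Quartet d x y z t ⇔ ((d z x < d x y × d t x < d x y) ⊎ (d x z < d z t × d y z < d z t))
Quartet⇔⊎ = mk⇔ (λ { (cherryˡ p q) → inj₁ (p , q) ; (cherryʳ p q) → inj₂ (p , q) })
                (λ { (inj₁ (p , q)) → cherryˡ p q ; (inj₂ (p , q)) → cherryʳ p q })

quartet? : ∀ {I : Set} (d : I → I → ℕ) x y z t → Dec (Quartet d x y z t)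
quartet? d x y z t = map (⇔-sym Quartet⇔⊎)
  (((d z x <? d x y) ×-dec (d t x <? d x y)) ⊎-dec ((d x z <? d z t) ×-dec (d y z <? d z t)))

Quartet-resp : ∀ {I J : Set} {d : I → I → ℕ} {d′ : J → J → ℕ} {x y z t x′ y′ z′ t′} →
               d′ z′ x′ ≡ d z x → d′ x′ y′ ≡ d x y → d′ t′ x′ ≡ d t x →
               d′ x′ z′ ≡ d x z → d′ z′ t′ ≡ d z t → d′ y′ z′ ≡ d y z →
               Quartet d x y z t → Quartet d′ x′ y′ z′ t′
Quartet-resp zx xy tx _  _  _  (cherryˡ p q) =
  cherryˡ (subst₂ _<_ (sym zx) (sym xy) p) (subst₂ _<_ (sym tx) (sym xy) q)
Quartet-resp _  _  _  xz zt yz (cherryʳ p q) =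
  cherryʳ (subst₂ _<_ (sym xz) (sym zt) p) (subst₂ _<_ (sym yz) (sym zt) q)

record MeetDepth (I : Set) : Set where
  field
    depth             : I → I → ℕ
    depth-sym         : ∀ x y → depth x y ≡ depth y x
    depth-ultrametric : ∀ x y z → depth x y ⊓ depth y z ≤ depth x z
    depth-binary      : ∀ x y z → y ≢ z → depth x y ≡ depth x z → depth x y < depth y z

module MeetDepthProperties {I : Set} (D : MeetDepth I) where
  open MeetDepth D

  private
    <-⊓ : ∀ {a b c} → c < a → c < b → c < a ⊓ b
    <-⊓ {a} {b} p q with ⊓-sel a b
    ... | inj₁ e = subst (_ <_) (sym e) p
    ... | inj₂ e = subst (_ <_) (sym e) q

    sym-< : ∀ {x y n} → depth x y < n → depth y x < n
    sym-< {x} {y} = subst (_< _) (depth-sym x y)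

  depth-isosceles : ∀ x y z → depth x y < depth y z → depth x z ≡ depth x y
  depth-isosceles x y z xy<yz = ≤-antisym ≤xy xy≤
    where
    xy≤ : depth x y ≤ depth x z
    xy≤ = subst (_≤ depth x z) (m≤n⇒m⊓n≡m (<⇒≤ xy<yz)) (depth-ultrametric x y z)
    ≤xy : depth x z ≤ depth x y
    ≤xy with depth x y <? depth x z
    ... | no xy≮xz = ≮⇒≥ xy≮xz
    ... | yes xy<xz = contradiction (depth-ultrametric x z y)
                        (<⇒≱ (<-⊓ xy<xz (subst (depth x y <_) (depth-sym y z) xy<yz)))

  depth-isoscelesˡ : ∀ x y z → depth x y < depth x z → depth y z ≡ depth x y
  depth-isoscelesˡ x y z xy<xz =
    trans (depth-isosceles y x z (subst (_< depth x z) (depth-sym x y) xy<xz)) (depth-sym y x)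

  depth-isoscelesʳ : ∀ x y z → depth x y < depth y z → depth y x ≡ depth z x
  depth-isoscelesʳ x y z xy<yz =
    trans (depth-sym y x) (trans (sym (depth-isosceles x y z xy<yz)) (depth-sym x z))

  private
    isosceles-<-trans : ∀ {x} u v w → depth x u < depth x v → depth x v < depth v w →
                        depth u v < depth v w
    isosceles-<-trans {x} u v w xu<xv xv<vw =
      subst (_< depth v w) (sym (depth-isoscelesˡ x u v xu<xv)) (<-trans xu<xv xv<vw)

  Quartet-swapˡ : ∀ {x y z t} → Quartet depth x y z t → Quartet depth y x z t
  Quartet-swapˡ {x} {y} {z} {t} (cherryˡ zx<xy tx<xy) = cherryˡ (swap zx<xy) (swap tx<xy)
    where
    swap : ∀ {w} → depth w x < depth x y → depth w y < depth y x
    swap {w} wx<xy = subst₂ _<_ (sym (depth-isosceles w x y wx<xy)) (depth-sym x y) wx<xy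
  Quartet-swapˡ (cherryʳ xz<zt yz<zt) = cherryʳ yz<zt xz<zt

  Quartet-swap : ∀ {x y z t} → Quartet depth x y z t → Quartet depth z t x y
  Quartet-swap (cherryˡ p q) = cherryʳ p q
  Quartet-swap (cherryʳ p q) = cherryˡ p q

  Quartet-exclusive : ∀ {x y z t} → Quartet depth x y z t → ¬ Quartet depth x z y t
  Quartet-exclusive {x} {y} {z} {t} (cherryˡ zx<xy _) (cherryˡ yx<xz _) =
    <-asym zx<xy (subst₂ _<_ (depth-sym y x) (depth-sym x z) yx<xz)
  Quartet-exclusive {x} {y} {z} {t} (cherryˡ _ tx<xy) (cherryʳ xy<yt _) =
    <-asym xy<yt (subst (_< depth x y) (trans (depth-sym t x) (depth-isoscelesʳ t x y tx<xy)) tx<xy)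
  Quartet-exclusive {x} {y} {z} {t} (cherryʳ xz<zt _) (cherryˡ _ tx<xz) =
    <-asym xz<zt (subst (_< depth x z) (trans (depth-sym t x) (depth-isoscelesʳ t x z tx<xz)) tx<xz)
  Quartet-exclusive {x} {y} {z} {t} (cherryʳ _ yz<zt) (cherryʳ _ zy<yt) =
    <-irrefl (depth-sym z y) (subst (depth z y <_) (depth-isosceles y z t yz<zt) zy<yt)

  Quartet-split : ∀ {x y z t} w → Quartet depth x y z t →
                  Quartet depth x y z w ⊎ Quartet depth x w z t
  Quartet-split {x} {y} {z} {t} w (cherryˡ zx<xy tx<xy) with depth w x <? depth x y
  ... | yes wx<xy = inj₁ (cherryˡ zx<xy wx<xy)
  ... | no wx≮xy = inj₂ (cherryˡ (<-≤-trans zx<xy xy≤xw) (<-≤-trans tx<xy xy≤xw))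
    where
    xy≤xw : depth x y ≤ depth x w
    xy≤xw = subst (depth x y ≤_) (depth-sym w x) (≮⇒≥ wx≮xy)
  Quartet-split {x} {y} {z} {t} w (cherryʳ xz<zt yz<zt) with depth w z <? depth z t
  ... | yes wz<zt = inj₂ (cherryʳ xz<zt wz<zt)
  ... | no wz≮zt = inj₁ (cherryʳ (<-≤-trans xz<zt zt≤zw) (<-≤-trans yz<zt zt≤zw))
    where
    zt≤zw : depth z t ≤ depth z w
    zt≤zw = subst (depth z t ≤_) (depth-sym w z) (≮⇒≥ wz≮zt)

  Quartet-trans : ∀ {a b x y z} → Quartet depth a b x y → Quartet depth a b x z →
                  Quartet depth a b y z
  Quartet-trans (cherryˡ _ ya<ab) (cherryˡ _ za<ab) = cherryˡ ya<ab za<ab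
  Quartet-trans {a} {b} {x} {y} {z} (cherryˡ xa<ab ya<ab) (cherryʳ ax<xz _) =
    cherryˡ ya<ab (subst (_< depth a b) (depth-isoscelesʳ a x z ax<xz) xa<ab)
  Quartet-trans {a} {b} {x} {y} {z} (cherryʳ ax<xy _) (cherryˡ xa<ab za<ab) =
    cherryˡ (subst (_< depth a b) (depth-isoscelesʳ a x y ax<xy) xa<ab) za<ab
  Quartet-trans {a} {b} {x} {y} {z} (cherryʳ ax<xy bx<xy) (cherryʳ ax<xz bx<xz) =
    cherryʳ (below ax<xy ax<xz) (below bx<xy bx<xz)
    where
    below : ∀ {w} → depth w x < depth x y → depth w x < depth x z → depth w y < depth y z
    below {w} wx<xy wx<xz =
      subst (_< depth y z) (sym (depth-isosceles w x y wx<xy))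
        (<-≤-trans (<-⊓ (subst (depth w x <_) (depth-sym x y) wx<xy) wx<xz) (depth-ultrametric y x z))

  -- Compare the depths of the meets of x with y, z and t: a strict maximum,
  -- or else the binary branching at a tie, singles out the cherry.
  Quartet-trichotomy : ∀ {x y z t} → y ≢ z → y ≢ t → z ≢ t →
    Quartet depth x y z t ⊎ Quartet depth x z y t ⊎ Quartet depth x t y z
  Quartet-trichotomy {x} {y} {z} {t} y≢z y≢t z≢t with <-cmp (depth x y) (depth x z)
  ... | tri< xy<xz _ _ with <-cmp (depth x z) (depth x t)
  ...   | tri< xz<xt _ _ = inj₂ (inj₂ (cherryˡ (sym-< (<-trans xy<xz xz<xt)) (sym-< xz<xt)))
  ...   | tri> _ _ xt<xz = inj₂ (inj₁ (cherryˡ (sym-< xy<xz) (sym-< xt<xz)))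
  ...   | tri≈ _ xz≡xt _ = inj₁ (cherryʳ xz<zt (isosceles-<-trans y z t xy<xz xz<zt))
    where
    xz<zt : depth x z < depth z t
    xz<zt = depth-binary x z t z≢t xz≡xt
  Quartet-trichotomy {x} {y} {z} {t} y≢z y≢t z≢t | tri> _ _ xz<xy with <-cmp (depth x y) (depth x t)
  ...   | tri> _ _ xt<xy = inj₁ (cherryˡ (sym-< xz<xy) (sym-< xt<xy))
  ...   | tri< xy<xt _ _ = inj₂ (inj₂ (cherryˡ (sym-< xy<xt) (sym-< (<-trans xz<xy xy<xt))))
  ...   | tri≈ _ xy≡xt _ = inj₂ (inj₁ (cherryʳ xy<yt (isosceles-<-trans z y t xz<xy xy<yt)))
    where
    xy<yt : depth x y < depth y t
    xy<yt = depth-binary x y t y≢t xy≡xt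
  Quartet-trichotomy {x} {y} {z} {t} y≢z y≢t z≢t | tri≈ _ xy≡xz _ with <-cmp (depth x y) (depth x t)
  ...   | tri> _ _ xt<xy = inj₂ (inj₂ (cherryʳ xy<yz (isosceles-<-trans t y z xt<xy xy<yz)))
    where
    xy<yz : depth x y < depth y z
    xy<yz = depth-binary x y z y≢z xy≡xz
  ...   | tri< xy<xt _ _ = inj₂ (inj₂ (cherryˡ (sym-< xy<xt) (sym-< (subst (_< depth x t) xy≡xz xy<xt))))
  ...   | tri≈ _ xy≡xt _ with <-cmp (depth y z) (depth y t)
  ...     | tri< yz<yt _ _ = inj₂ (inj₁ (cherryʳ (depth-binary x y t y≢t xy≡xt) (sym-< yz<yt)))
  ...     | tri> _ _ yt<yz = inj₂ (inj₂ (cherryʳ (depth-binary x y z y≢z xy≡xz) (sym-< yt<yz)))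
  ...     | tri≈ _ yz≡yt _ =
    inj₁ (cherryʳ (depth-binary x z t z≢t (trans (sym xy≡xz) xy≡xt)) (depth-binary y z t z≢t yz≡yt))

-- Q_d on the homogeneous binary branching C-relation

Distinct4 : ∀ {A : Set} → A → A → A → A → Set
Distinct4 x y z t = x ≢ y × x ≢ z × x ≢ t × y ≢ z × y ≢ t × z ≢ t

distinct4? : ∀ {A : Set} → DecidableEquality A → ∀ x y z t → Dec (Distinct4 x y z t)
distinct4? _≟_ x y z t =
  ¬? (x ≟ y) ×-dec ¬? (x ≟ z) ×-dec ¬? (x ≟ t) ×-dec ¬? (y ≟ z) ×-dec ¬? (y ≟ t) ×-dec ¬? (z ≟ t)

Distinct4-map : ∀ {A B : Set} (f : A → B) → (∀ {x y} → f x ≡ f y → x ≡ y) →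
                ∀ {x y z t} → Distinct4 x y z t → Distinct4 (f x) (f y) (f z) (f t)
Distinct4-map f f-inj (xy , xz , xt , yz , yt , zt) =
  xy ∘ f-inj , xz ∘ f-inj , xt ∘ f-inj , yz ∘ f-inj , yt ∘ f-inj , zt ∘ f-inj

Distinct4⇒Unique : ∀ {A : Set} {x y z t : A} → Distinct4 x y z t →
                   Unique (x ∷ y ∷ z ∷ t ∷ [])
Distinct4⇒Unique (xy , xz , xt , yz , yt , zt) =
  (xy ∷ xz ∷ xt ∷ []) ∷ (yz ∷ yt ∷ []) ∷ (zt ∷ []) ∷ [] ∷ []

lookup-injective : ∀ {A : Set} {xs : List A} → Unique xs →
                   ∀ {i j} → lookup xs i ≡ lookup xs j → i ≡ j
lookup-injective (_ ∷ _)  {zero}  {zero}  _ = refl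
lookup-injective (x∉ ∷ _) {zero}  {suc j} e = contradiction e (All.lookup x∉ (∈-lookup j))
lookup-injective (x∉ ∷ _) {suc i} {zero}  e = contradiction (sym e) (All.lookup x∉ (∈-lookup i))
lookup-injective (_ ∷ u)  {suc i} {suc j} e = cong suc (lookup-injective u e)

module HomogeneousC {L : Set} {C : L → L → L → Set} (H : IsHomBinBranchC L C) where
  open IsHomBinBranchC H

  Q : L → L → L → L → Set
  Q = Qd C

  module _ {x y z t : L} (q : Q x y z t) where
    ≢₁₂ : x ≢ y
    ≢₁₂ = proj₁ (proj₁ q)
    ≢₁₃ : x ≢ z
    ≢₁₃ = proj₁ (proj₂ (proj₁ q))
    ≢₁₄ : x ≢ t
    ≢₁₄ = proj₁ (proj₂ (proj₂ (proj₁ q)))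
    ≢₂₃ : y ≢ z
    ≢₂₃ = proj₁ (proj₂ (proj₂ (proj₂ (proj₁ q))))
    ≢₂₄ : y ≢ t
    ≢₂₄ = proj₁ (proj₂ (proj₂ (proj₂ (proj₂ (proj₁ q)))))
    ≢₃₄ : z ≢ t
    ≢₃₄ = proj₂ (proj₂ (proj₂ (proj₂ (proj₂ (proj₁ q)))))

  _≟_ : DecidableEquality L
  _≟_ = via-injection (↔⇒↣ (↔-sym countable)) ℕ._≟_

  record Realises {k} (e : Fin k → L) {T} (g : Fin k → Leaf T) : Set where
    field
      e-injective : ∀ {i j} → e i ≡ e j → i ≡ j
      g-injective : ∀ {i j} → g i ≡ g j → i ≡ j
      C⇔CT        : ∀ i j l → C (e i) (e j) (e l) ⇔ CT (g i) (g j) (g l)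

  record Realisation {k} (e : Fin k → L) : Set where
    field
      tree     : BTree
      leafOf   : Fin k → Leaf tree
      realises : Realises e leafOf

  realise : ∀ {x xs} → Unique (x ∷ xs) → Realisation (lookup (x ∷ xs))
  realise {x} {xs} u with age-⊆ _ (lookup (x ∷ xs)) (λ _ _ → lookup-injective u)
  ... | T , β , C⇔CT = record
    { tree = T ; leafOf = Inverse.to β
    ; realises = record
      { e-injective = lookup-injective u
      ; g-injective = Injection.injective (↔⇒↣ β)
      ; C⇔CT = C⇔CT } }

  module Realised {k} {e : Fin k → L} {T} {g : Fin k → Leaf T} (R : Realises e g) where
    open Realises R

    meetDepth : MeetDepth (Fin k)
    meetDepth = record
      { depth             = λ i j → yca₂ (g i) (g j)
      ; depth-sym         = λ i j → yca₂-sym (g i) (g j)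
      ; depth-ultrametric = λ i j l → yca₂-ultrametric (g i) (g j) (g l)
      ; depth-binary      = λ i j l j≢l → yca₂-binary (g i) (g j) (g l) (j≢l ∘ g-injective)
      }

    open MeetDepth meetDepth public using (depth)
    open MeetDepthProperties meetDepth public

    C⇔depth< : ∀ i j l → C (e i) (e j) (e l) ⇔ depth i j < depth j l
    C⇔depth< i j l = CT⇔yca₂< (g i) (g j) (g l) ⇔-∘ C⇔CT i j l

    Q⇔Quartet : ∀ i j l t → Q (e i) (e j) (e l) (e t) ⇔
                (Distinct4 (e i) (e j) (e l) (e t) × Quartet depth i j l t)
    Q⇔Quartet i j l t = ⇔-id _ ×-⇔ (⇔-sym Quartet⇔⊎ ⇔-∘
      ((C⇔depth< l i j ×-⇔ C⇔depth< t i j) ⊎-⇔ (C⇔depth< i l t ×-⇔ C⇔depth< j l t)))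

    Q⇒Quartet : ∀ i j l t → Q (e i) (e j) (e l) (e t) → Quartet depth i j l t
    Q⇒Quartet i j l t = proj₂ ∘ Equivalence.to (Q⇔Quartet i j l t)

    Quartet⇒Q′ : ∀ i j l t → Distinct4 (e i) (e j) (e l) (e t) →
                 Quartet depth i j l t → Q (e i) (e j) (e l) (e t)
    Quartet⇒Q′ i j l t d q = Equivalence.from (Q⇔Quartet i j l t) (d , q)

    -- For literal indices the distinctness premise evaluates to ⊤ and is inferred.
    Quartet⇒Q : ∀ i j l t {_ : True (distinct4? Fin._≟_ i j l t)} →
                Quartet depth i j l t → Q (e i) (e j) (e l) (e t)
    Quartet⇒Q i j l t {distinct} = Quartet⇒Q′ i j l t (Distinct4-map e e-injective (toWitness distinct))

  private
    module Realised₄ {x y z t} (d : Distinct4 x y z t) =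
      Realised (Realisation.realises (realise (Distinct4⇒Unique d)))

  Q-swapˡ : ∀ {x y z t} → Q x y z t → Q y x z t
  Q-swapˡ q =
    Quartet⇒Q (# 1) (# 0) (# 2) (# 3) (Quartet-swapˡ (Q⇒Quartet (# 0) (# 1) (# 2) (# 3) q))
    where open Realised₄ (proj₁ q)

  Q-swap : ∀ {x y z t} → Q x y z t → Q z t x y
  Q-swap q =
    Quartet⇒Q (# 2) (# 3) (# 0) (# 1) (Quartet-swap (Q⇒Quartet (# 0) (# 1) (# 2) (# 3) q))
    where open Realised₄ (proj₁ q)

  Q-swapʳ : ∀ {x y z t} → Q x y z t → Q x y t z
  Q-swapʳ = Q-swap ∘ Q-swapˡ ∘ Q-swap

  Q-exclusive : ∀ {x y z t} → Q x y z t → ¬ Q x z y t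
  Q-exclusive q q′ =
    Quartet-exclusive (Q⇒Quartet (# 0) (# 1) (# 2) (# 3) q) (Q⇒Quartet (# 0) (# 2) (# 1) (# 3) q′)
    where open Realised₄ (proj₁ q)

  Q-trichotomy : ∀ {x y z t} → Distinct4 x y z t → Q x y z t ⊎ Q x z y t ⊎ Q x t y z
  Q-trichotomy d =
    Sum.map (Quartet⇒Q (# 0) (# 1) (# 2) (# 3))
            (Sum.map (Quartet⇒Q (# 0) (# 2) (# 1) (# 3)) (Quartet⇒Q (# 0) (# 3) (# 1) (# 2)))
            (Quartet-trichotomy {# 0} {# 1} {# 2} {# 3} (λ ()) (λ ()) (λ ()))
    where open Realised₄ d

  private
    module Realised₅ {w x y z t} (w∉ : All (w ≢_) (x ∷ y ∷ z ∷ t ∷ [])) (d : Distinct4 x y z t) =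
      Realised (Realisation.realises (realise (w∉ ∷ Distinct4⇒Unique d)))

  Q-split : ∀ {x y z t w} → Q x y z t → w ≢ x → w ≢ y → w ≢ z → w ≢ t →
            Q x y z w ⊎ Q x w z t
  Q-split q wx wy wz wt =
    Sum.map (Quartet⇒Q (# 1) (# 2) (# 3) (# 0)) (Quartet⇒Q (# 1) (# 0) (# 3) (# 4))
      (Quartet-split (# 0) (Q⇒Quartet (# 1) (# 2) (# 3) (# 4) q))
    where open Realised₅ (wx ∷ wy ∷ wz ∷ wt ∷ []) (proj₁ q)

  Q-trans : ∀ {a b x y z} → Q a b x y → Q a b x z → y ≢ z → Q a b y z
  Q-trans q q′ y≢z =
    Quartet⇒Q (# 1) (# 2) (# 4) (# 0)
      (Quartet-trans (Q⇒Quartet (# 1) (# 2) (# 3) (# 4) q) (Q⇒Quartet (# 1) (# 2) (# 3) (# 0) q′))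
    where
    open Realised₅ (≢-sym (≢₁₄ q′) ∷ ≢-sym (≢₂₄ q′) ∷ ≢-sym (≢₃₄ q′) ∷ ≢-sym y≢z ∷ []) (proj₁ q)

  Q? : ∀ x y z t → Dec (Q x y z t)
  Q? x y z t with distinct4? _≟_ x y z t
  ... | no ¬d = no (¬d ∘ proj₁)
  ... | yes d = map′ (Quartet⇒Q (# 0) (# 1) (# 2) (# 3)) (Q⇒Quartet (# 0) (# 1) (# 2) (# 3))
                     (quartet? depth (# 0) (# 1) (# 2) (# 3))
    where open Realised₄ d

  -- One-point extension property: embed T' into L, and use homogeneity to move
  -- the image of g back onto e.
  extend : ∀ {k T T'} {e : Fin k → L} {g : Fin k → Leaf T} → Realises e g →
           (ι : Leaf T → Leaf T') → (∀ {x y} → ι x ≡ ι y → x ≡ y) →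
           (∀ x y z → CT (ι x) (ι y) (ι z) ⇔ CT x y z) →
           (ℓ : Leaf T') → (∀ x → ℓ ≢ ι x) →
           ∃ λ p → Realises (p ◂ e) (ℓ ◂ ι ∘ g)
  extend {k} {T' = T'} {e} {g} R ι ι-injective ι-CT ℓ ℓ∉ι =
    p , record { e-injective = e′-injective ; g-injective = g′-injective ; C⇔CT = C⇔CT′ }
    where
    open Realises R
    emb : Leaf T' → L
    emb = proj₁ (age-⊇ T')
    emb-injective : ∀ {x y} → emb x ≡ emb y → x ≡ y
    emb-injective = proj₁ (proj₂ (age-⊇ T')) _ _
    CT⇔C-emb : ∀ x y z → CT x y z ⇔ C (emb x) (emb y) (emb z)
    CT⇔C-emb = proj₂ (proj₂ (age-⊇ T'))

    f : Fin k → L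
    f = emb ∘ ι ∘ g
    C-f⇔C-e : ∀ i j l → C (f i) (f j) (f l) ⇔ C (e i) (e j) (e l)
    C-f⇔C-e i j l = ⇔-sym (C⇔CT i j l) ⇔-∘ (ι-CT (g i) (g j) (g l) ⇔-∘ ⇔-sym (CT⇔C-emb _ _ _))

    homogeneity : Σ (L ↔ L) λ σ →
                    (∀ x y z → C x y z ⇔ C (Inverse.to σ x) (Inverse.to σ y) (Inverse.to σ z))
                    × (∀ i → Inverse.to σ (f i) ≡ e i)
    homogeneity = homogeneous k f e (λ _ _ → g-injective ∘ ι-injective ∘ emb-injective)
                                    (λ _ _ → e-injective) C-f⇔C-e
    σ : L → L
    σ = Inverse.to (proj₁ homogeneity)
    σ-injective : ∀ {x y} → σ x ≡ σ y → x ≡ y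
    σ-injective = Injection.injective (↔⇒↣ (proj₁ homogeneity))
    σ-C : ∀ x y z → C x y z ⇔ C (σ x) (σ y) (σ z)
    σ-C = proj₁ (proj₂ homogeneity)

    p : L
    p = σ (emb ℓ)
    g′ : Fin (suc k) → Leaf T'
    g′ = ℓ ◂ ι ∘ g
    e′≡σ∘emb∘g′ : ∀ i → (p ◂ e) i ≡ σ (emb (g′ i))
    e′≡σ∘emb∘g′ zero    = refl
    e′≡σ∘emb∘g′ (suc i) = sym (proj₂ (proj₂ homogeneity) i)

    g′-injective : ∀ {i j} → g′ i ≡ g′ j → i ≡ j
    g′-injective {zero}  {zero}  _  = refl
    g′-injective {zero}  {suc j} eq = contradiction eq (ℓ∉ι (g j))
    g′-injective {suc i} {zero}  eq = contradiction (sym eq) (ℓ∉ι (g i))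
    g′-injective {suc i} {suc j} eq = cong suc (g-injective (ι-injective eq))
    e′-injective : ∀ {i j} → (p ◂ e) i ≡ (p ◂ e) j → i ≡ j
    e′-injective {i} {j} eq =
      g′-injective (emb-injective (σ-injective (trans (sym (e′≡σ∘emb∘g′ i)) (trans eq (e′≡σ∘emb∘g′ j)))))
    C⇔CT′ : ∀ i j l → C ((p ◂ e) i) ((p ◂ e) j) ((p ◂ e) l) ⇔ CT (g′ i) (g′ j) (g′ l)
    C⇔CT′ i j l rewrite e′≡σ∘emb∘g′ i | e′≡σ∘emb∘g′ j | e′≡σ∘emb∘g′ l =
      ⇔-sym (σ-C _ _ _ ⇔-∘ CT⇔C-emb _ _ _)

  record Twin (p : L) (xs : List L) : Set where
    field
      twin          : L
      twin-fresh    : ∀ {y} → y ∈ p ∷ xs → twin ≢ y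
      twin-replaces : ∀ {y z w} → y ∈ p ∷ xs → z ∈ p ∷ xs → w ∈ p ∷ xs →
                      Q p y z w → Q twin y z w
      twin-cherry   : ∀ {y z} → y ∈ p ∷ xs → z ∈ p ∷ xs → y ≢ z → p ≢ y → p ≢ z → Q p twin y z

  -- The twin is the image of the new leaf when the leaf of p is grafted.
  twin-unique : ∀ {p ys} → Unique (p ∷ ys) → Twin p ys
  twin-unique {p} {ys} u = record
    { twin          = p′
    ; twin-fresh    = λ y∈ → subst (p′ ≢_) (sym (lookup-index y∈)) (fresh (index y∈))
    ; twin-replaces = replaces
    ; twin-cherry   = cherry
    }
    where
    open Realisation (realise u)
    open Realises realises using (g-injective)
    e : Fin (suc (length ys)) → L
    e = lookup (p ∷ ys)
    g : Fin (suc (length ys)) → Leaf tree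
    g = leafOf
    extension : ∃ λ p′ → Realises (p′ ◂ e) (new (g zero) ◂ old (g zero) ∘ g)
    extension = extend realises (old (g zero)) (old-injective (g zero))
                  (CT-preserved (old (g zero)) (old-injective (g zero)) (yca₂-old (g zero)))
                  (new (g zero)) (new≢old (g zero))
    p′ : L
    p′ = proj₁ extension
    module Before = Realised realises
    module After = Realised (proj₂ extension)

    fresh : ∀ i → p′ ≢ e i
    fresh i eq with Realises.e-injective (proj₂ extension) {zero} {suc i} eq
    ... | ()

    leaf≢ : ∀ i j → e i ≢ e j → g i ≢ g j
    leaf≢ _ _ ei≢ej = ei≢ej ∘ cong e ∘ g-injective

    depth-new : ∀ i → e i ≢ p → After.depth zero (suc i) ≡ Before.depth zero i
    depth-new i i≢0 = yca₂-new-old (g zero) (g i) (leaf≢ i zero i≢0)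
    depth-newˡ : ∀ i → e i ≢ p → After.depth (suc i) zero ≡ Before.depth i zero
    depth-newˡ i i≢0 = trans (yca₂-sym _ _) (trans (depth-new i i≢0) (yca₂-sym _ _))
    depth-old : ∀ i j → e i ≢ e j → After.depth (suc i) (suc j) ≡ Before.depth i j
    depth-old i j i≢j = yca₂-old (g zero) (leaf≢ i j i≢j)

    replaces-at : ∀ i j l → Q p (e i) (e j) (e l) → Q p′ (e i) (e j) (e l)
    replaces-at i j l q@((pi , pj , pl , ij , il , jl) , _) =
      After.Quartet⇒Q′ zero (suc i) (suc j) (suc l) (fresh i , fresh j , fresh l , ij , il , jl)
        (Quartet-resp (depth-newˡ j (≢-sym pj)) (depth-new i (≢-sym pi)) (depth-newˡ l (≢-sym pl))
                      (depth-new j (≢-sym pj)) (depth-old j l jl) (depth-old i j ij)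
                      (Before.Q⇒Quartet zero i j l q))

    replaces : ∀ {y z w} → y ∈ p ∷ ys → z ∈ p ∷ ys → w ∈ p ∷ ys → Q p y z w → Q p′ y z w
    replaces y∈ z∈ w∈ rewrite lookup-index y∈ | lookup-index z∈ | lookup-index w∈ =
      replaces-at (index y∈) (index z∈) (index w∈)

    cherry : ∀ {y z} → y ∈ p ∷ ys → z ∈ p ∷ ys → y ≢ z → p ≢ y → p ≢ z → Q p p′ y z
    cherry y∈ z∈ rewrite lookup-index y∈ | lookup-index z∈ = cherry-at (index y∈) (index z∈)
      where
      cherry-at : ∀ i j → e i ≢ e j → p ≢ e i → p ≢ e j → Q p p′ (e i) (e j)
      cherry-at i j ij pi pj =
        After.Quartet⇒Q′ (suc zero) zero (suc i) (suc j)
          (≢-sym (fresh zero) , pi , pj , fresh i , fresh j , ij)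
          (cherryˡ (yca₂-old<yca₂-old-new (g zero) (g i) (leaf≢ i zero (≢-sym pi)))
                   (yca₂-old<yca₂-old-new (g zero) (g j) (leaf≢ j zero (≢-sym pj))))

  twinOf : ∀ p xs → Twin p xs
  twinOf p xs = record
    { twin          = twin
    ; twin-fresh    = twin-fresh ∘ dedup⁺
    ; twin-replaces = λ y∈ z∈ w∈ → twin-replaces (dedup⁺ y∈) (dedup⁺ z∈) (dedup⁺ w∈)
    ; twin-cherry   = λ y∈ z∈ → twin-cherry (dedup⁺ y∈) (dedup⁺ z∈)
    }
    where
    open Twin (twin-unique (UniqueDec.deduplicate-! _≟_ (p ∷ xs)))
    dedup⁺ : ∀ {y} → y ∈ p ∷ xs → y ∈ deduplicate _≟_ (p ∷ xs)
    dedup⁺ = ∈-deduplicate⁺ _≟_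

-- Gadgets, relative to three distinct constants

pattern ∈₀ = here refl
pattern ∈₁ = there ∈₀
pattern ∈₂ = there ∈₁
pattern ∈₃ = there ∈₂
pattern ∈₄ = there ∈₃
pattern ∈₅ = there ∈₄
pattern ∈₆ = there ∈₅

module Gadgets {L : Set} {C : L → L → L → Set} (H : IsHomBinBranchC L C)
               (a b c : L) (a≢b : a ≢ b) (a≢c : a ≢ c) (b≢c : b ≢ c) where
  open HomogeneousC H
  open Twin

  NearA NearB Domain : L → Set
  NearA x  = Q x a b c
  NearB x  = Q x b a c
  Domain x = NearA x ⊎ NearB x

  module _ {x : L} where
    domain-≢a : Domain x → x ≢ a
    domain-≢a = [ ≢₁₂ , ≢₁₃ ]
    domain-≢b : Domain x → x ≢ b
    domain-≢b = [ ≢₁₃ , ≢₁₂ ]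
    domain-≢c : Domain x → x ≢ c
    domain-≢c = [ ≢₁₄ , ≢₁₄ ]

  DomainWitness : L → L → L → Set
  DomainWitness x u₀ u₁ = Q a u₁ b u₀ × Q a x c u₀ × Q b x c u₁

  domain-sound : ∀ {x u₀ u₁} → DomainWitness x u₀ u₁ → Domain x
  domain-sound {x} {u₀} {u₁} (au₁∣bu₀ , ax∣cu₀ , bx∣cu₁)
    with Q-trichotomy (≢-sym (≢₁₂ ax∣cu₀) , ≢-sym (≢₁₂ bx∣cu₁) , ≢₂₃ ax∣cu₀ , a≢b , a≢c , b≢c)
  ... | inj₁ xa∣bc        = inj₁ xa∣bc
  ... | inj₂ (inj₁ xb∣ac) = inj₂ xb∣ac
  ... | inj₂ (inj₂ xc∣ab) = contradiction (Q-swapʳ ab∣u₀u₁) (Q-exclusive au₁∣bu₀)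
    where
    xu₀∣ab : Q x u₀ a b
    xu₀∣ab = [ ⊥-elim ∘ Q-exclusive (Q-swapˡ ax∣cu₀) , id ]
      (Q-split xc∣ab (≢-sym (≢₂₄ ax∣cu₀)) (≢-sym (≢₃₄ ax∣cu₀)) (≢-sym (≢₁₄ ax∣cu₀)) (≢-sym (≢₃₄ au₁∣bu₀)))
    xu₁∣ba : Q x u₁ b a
    xu₁∣ba = [ ⊥-elim ∘ Q-exclusive (Q-swapˡ bx∣cu₁) , id ]
      (Q-split (Q-swapʳ xc∣ab) (≢-sym (≢₂₄ bx∣cu₁)) (≢-sym (≢₃₄ bx∣cu₁)) (≢-sym (≢₁₄ bx∣cu₁))
                               (≢-sym (≢₁₂ au₁∣bu₀)))
    ab∣u₀u₁ : Q a b u₀ u₁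
    ab∣u₀u₁ = Q-trans (Q-swap xu₀∣ab) (Q-swapˡ (Q-swap xu₁∣ba)) (≢-sym (≢₂₄ au₁∣bu₀))

  domain-complete : ∀ {x} → NearA x → ∃₂ (DomainWitness x)
  domain-complete {x} xa∣bc = u₀ , u₁ , au₁∣bu₀ , ax∣cu₀ , bx∣cu₁
    where
    T₀ : Twin b (a ∷ c ∷ x ∷ [])
    T₀ = twinOf b _
    u₀ : L
    u₀ = twin T₀
    T₁ : Twin c (a ∷ b ∷ x ∷ u₀ ∷ [])
    T₁ = twinOf c _
    u₁ : L
    u₁ = twin T₁
    ax∣cu₀ : Q a x c u₀
    ax∣cu₀ = Q-swapʳ (Q-swapˡ (Q-swap (twin-replaces T₀ ∈₂ ∈₃ ∈₁ (Q-swap xa∣bc))))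
    bx∣cu₁ : Q b x c u₁
    bx∣cu₁ = Q-swap (twin-cherry T₁ ∈₂ ∈₃ (≢-sym (≢₁₃ xa∣bc)) (≢-sym b≢c) (≢-sym (≢₁₄ xa∣bc)))
    au₁∣bu₀ : Q a u₁ b u₀
    au₁∣bu₀ = Q-swapˡ (twin-replaces T₁ ∈₁ ∈₂ ∈₄
                (Q-swapˡ (Q-swap (twin-cherry T₀ ∈₁ ∈₂ a≢c (≢-sym a≢b) b≢c))))

  SameSideWitness : L → L → L → Set
  SameSideWitness x y u = Q b c u x × Q a c u y

  sameSide-complete : ∀ {x y} → NearA x → NearA y → ∃ (SameSideWitness x y)
  sameSide-complete {x} {y} xa∣bc ya∣bc with x ≟ y
  ... | yes refl = twin T , Q-swapʳ (Q-swap (twin-cherry T ∈₂ ∈₃ b≢c (≢₁₃ xa∣bc) (≢₁₄ xa∣bc)))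
                          , Q-swapʳ (Q-swap (twin-cherry T ∈₁ ∈₃ a≢c (≢₁₂ xa∣bc) (≢₁₄ xa∣bc)))
    where
    T : Twin x (a ∷ b ∷ c ∷ [])
    T = twinOf x _
  ... | no x≢y = twin T , Q-swap (twin-replaces T ∈₄ ∈₂ ∈₃ (Q-swapˡ (Q-swap bc∣xy)))
                        , Q-swapʳ (Q-swap (twin-cherry T ∈₁ ∈₃ a≢c (≢₁₂ ya∣bc) (≢₁₄ ya∣bc)))
    where
    T : Twin y (a ∷ b ∷ c ∷ x ∷ [])
    T = twinOf y _
    bc∣xy : Q b c x y
    bc∣xy = Q-trans (Q-swapʳ (Q-swap xa∣bc)) (Q-swapʳ (Q-swap ya∣bc)) x≢y

  sameSide-sound : ∀ {x y u} → NearA x → NearB y → ¬ SameSideWitness x y u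
  sameSide-sound {u = u} xa∣bc yb∣ac (bc∣ux , ac∣uy) = Q-exclusive (Q-swapˡ bc∣au) (Q-swapˡ ac∣bu)
    where
    bc∣au : Q b c a u
    bc∣au = Q-trans (Q-swap xa∣bc) (Q-swapʳ bc∣ux) (≢₁₃ ac∣uy)
    ac∣bu : Q a c b u
    ac∣bu = Q-trans (Q-swap yb∣ac) (Q-swapʳ ac∣uy) (≢₁₃ bc∣ux)

  nearB-witness : ∀ {x u} → NearB x → Q b c u x → NearB u
  nearB-witness {x} {u} xb∣ac bc∣ux with u ≟ a
  ... | yes refl = contradiction xb∣ac (Q-exclusive (Q-swapˡ (Q-swap bc∣ux)))
  ... | no u≢a with Q-split xb∣ac (≢₃₄ bc∣ux) (≢-sym (≢₁₃ bc∣ux)) u≢a (≢-sym (≢₂₃ bc∣ux))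
  ...   | inj₁ xb∣au = contradiction (Q-swapʳ bc∣ux)
                         (Q-exclusive (Q-trans (Q-swapˡ xb∣ac) (Q-swapˡ xb∣au) (≢₂₃ bc∣ux)))
  ...   | inj₂ xu∣ac = Q-swap (Q-trans (Q-swap xu∣ac) (Q-swap xb∣ac) (≢-sym (≢₁₃ bc∣ux)))

  NotAllNearBWitness : L → L → L → L → L → Set
  NotAllNearBWitness x y z u₀ u₁ = Q a x c u₁ × Q a y u₀ u₁ × Q a z b u₀

  notAllNearB-sound : ∀ {x y z u₀ u₁} → NotAllNearBWitness x y z u₀ u₁ →
                      ¬ (NearB x × NearB y × NearB z)
  notAllNearB-sound {x} {y} {z} {u₀} {u₁} (ax∣cu₁ , ay∣u₀u₁ , az∣bu₀) (xb∣ac , yb∣ac , zb∣ac)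
    with u₀ ≟ c | u₁ ≟ b
  ... | yes refl | _        = Q-exclusive (Q-swapˡ az∣bu₀) zb∣ac
  ... | no _     | yes refl = Q-exclusive (Q-swapʳ (Q-swapˡ ax∣cu₁)) xb∣ac
  ... | no u₀≢c  | no u₁≢b  =
    [ (λ ay∣u₀c → Q-exclusive (Q-swapʳ ac∣u₀y) (Q-swapʳ ay∣u₀c))
    , (λ ac∣u₀u₁ → Q-exclusive ab∣cu₁ (Q-trans ac∣u₀b ac∣u₀u₁ (≢-sym u₁≢b))) ]
      (Q-split ay∣u₀u₁ (≢-sym a≢c) (≢-sym (≢₁₄ yb∣ac)) (≢-sym u₀≢c) (≢₃₄ ax∣cu₁))
    where
    zu₀∣ac : Q z u₀ a c
    zu₀∣ac = [ ⊥-elim ∘ Q-exclusive (Q-swapˡ az∣bu₀) , id ]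
      (Q-split zb∣ac (≢-sym (≢₂₄ az∣bu₀)) (≢-sym (≢₃₄ az∣bu₀)) (≢-sym (≢₁₄ az∣bu₀)) u₀≢c)
    ac∣u₀b : Q a c u₀ b
    ac∣u₀b = Q-trans (Q-swap zu₀∣ac) (Q-swap zb∣ac) (≢-sym (≢₃₄ az∣bu₀))
    ab∣cu₁ : Q a b c u₁
    ab∣cu₁ = [ (λ ax∣cb → ⊥-elim (Q-exclusive (Q-swapʳ (Q-swapˡ ax∣cb)) xb∣ac)) , id ]
      (Q-split ax∣cu₁ (≢-sym a≢b) (≢-sym (≢₁₂ xb∣ac)) b≢c (≢-sym u₁≢b))
    ac∣u₀y : Q a c u₀ y
    ac∣u₀y = Q-trans (Q-swapʳ ac∣u₀b) (Q-swapʳ (Q-swap yb∣ac)) (≢-sym (≢₂₃ ay∣u₀u₁))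

  module _ {x y z : L} where
    notAllNearB-complete₁ : NearA x → Domain y → Domain z → ∃₂ (NotAllNearBWitness x y z)
    notAllNearB-complete₁ xa∣bc dy dz = u₀ , u₁ , ax∣cu₁ , ay∣u₀u₁ , az∣bu₀
      where
      T₀ : Twin b (a ∷ c ∷ x ∷ y ∷ z ∷ [])
      T₀ = twinOf b _
      u₀ : L
      u₀ = twin T₀
      T₁ : Twin u₀ (a ∷ b ∷ c ∷ x ∷ y ∷ z ∷ [])
      T₁ = twinOf u₀ _
      u₁ : L
      u₁ = twin T₁
      az∣bu₀ : Q a z b u₀
      az∣bu₀ = Q-swap (twin-cherry T₀ ∈₁ ∈₅ (≢-sym (domain-≢a dz)) (≢-sym a≢b) (≢-sym (domain-≢b dz)))
      ay∣u₀u₁ : Q a y u₀ u₁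
      ay∣u₀u₁ = Q-swap (twin-cherry T₁ ∈₁ ∈₅ (≢-sym (domain-≢a dy)) (twin-fresh T₀ ∈₁) (twin-fresh T₀ ∈₄))
      ax∣cu₁ : Q a x c u₁
      ax∣cu₁ = Q-swapʳ (Q-swapˡ (Q-swap (twin-replaces T₁ ∈₃ ∈₄ ∈₁
                 (twin-replaces T₀ ∈₂ ∈₃ ∈₁ (Q-swap xa∣bc)))))

    notAllNearB-complete₂ : Domain x → NearA y → Domain z → ∃₂ (NotAllNearBWitness x y z)
    notAllNearB-complete₂ dx ya∣bc dz = u₀ , u₁ , ax∣cu₁ , ay∣u₀u₁ , az∣bu₀
      where
      T₀ : Twin b (a ∷ c ∷ x ∷ y ∷ z ∷ [])
      T₀ = twinOf b _
      u₀ : L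
      u₀ = twin T₀
      T₁ : Twin c (a ∷ b ∷ x ∷ y ∷ z ∷ u₀ ∷ [])
      T₁ = twinOf c _
      u₁ : L
      u₁ = twin T₁
      az∣bu₀ : Q a z b u₀
      az∣bu₀ = Q-swap (twin-cherry T₀ ∈₁ ∈₅ (≢-sym (domain-≢a dz)) (≢-sym a≢b) (≢-sym (domain-≢b dz)))
      ax∣cu₁ : Q a x c u₁
      ax∣cu₁ = Q-swap (twin-cherry T₁ ∈₁ ∈₃ (≢-sym (domain-≢a dx)) (≢-sym a≢c) (≢-sym (domain-≢c dx)))
      ay∣u₀u₁ : Q a y u₀ u₁
      ay∣u₀u₁ = Q-swapʳ (Q-swapˡ (Q-swap (twin-replaces T₁ ∈₆ ∈₄ ∈₁
                  (Q-swapˡ (twin-replaces T₀ ∈₂ ∈₄ ∈₁ (Q-swap ya∣bc))))))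

    notAllNearB-complete₃ : Domain x → Domain y → NearA z → ∃₂ (NotAllNearBWitness x y z)
    notAllNearB-complete₃ dx dy za∣bc = u₀ , u₁ , ax∣cu₁ , ay∣u₀u₁ , az∣bu₀
      where
      T₀ : Twin c (a ∷ b ∷ x ∷ y ∷ z ∷ [])
      T₀ = twinOf c _
      u₀ : L
      u₀ = twin T₀
      T₁ : Twin u₀ (a ∷ b ∷ c ∷ x ∷ y ∷ z ∷ [])
      T₁ = twinOf u₀ _
      u₁ : L
      u₁ = twin T₁
      az∣bu₀ : Q a z b u₀
      az∣bu₀ = Q-swapʳ (Q-swapˡ (Q-swap (twin-replaces T₀ ∈₂ ∈₅ ∈₁ (Q-swapˡ (Q-swap za∣bc)))))
      ay∣u₀u₁ : Q a y u₀ u₁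
      ay∣u₀u₁ = Q-swap (twin-cherry T₁ ∈₁ ∈₅ (≢-sym (domain-≢a dy)) (twin-fresh T₀ ∈₁) (twin-fresh T₀ ∈₄))
      ax∣cu₁ : Q a x c u₁
      ax∣cu₁ = Q-swap (Q-swapˡ (twin-replaces T₁ ∈₃ ∈₁ ∈₄
                 (Q-swapˡ (twin-cherry T₀ ∈₁ ∈₃ (≢-sym (domain-≢a dx)) (≢-sym a≢c) (≢-sym (domain-≢c dx))))))

    notAllNearB : Domain x → Domain y → Domain z →
                  (¬ (NearB x × NearB y × NearB z)) ⇔ ∃₂ (NotAllNearBWitness x y z)
    notAllNearB dx dy dz = mk⇔ (complete dx dy dz) (λ (_ , _ , w) → notAllNearB-sound w)
      where
      complete : Domain x → Domain y → Domain z →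
                 ¬ (NearB x × NearB y × NearB z) → ∃₂ (NotAllNearBWitness x y z)
      complete (inj₁ xA) _         _         _    = notAllNearB-complete₁ xA dy dz
      complete (inj₂ _)  (inj₁ yA) _         _    = notAllNearB-complete₂ dx yA dz
      complete (inj₂ _)  (inj₂ _)  (inj₁ zA) _    = notAllNearB-complete₃ dx dy zA
      complete (inj₂ xB) (inj₂ yB) (inj₂ zB) ¬all = contradiction (xB , yB , zB) ¬all

-- The interpretation

module Interpretation {L : Set} {C : L → L → L → Set} (H : IsHomBinBranchC L C)
                      (a b c : L) (a≢b : a ≢ b) (a≢c : a ≢ c) (b≢c : b ≢ c) where
  open HomogeneousC H
  open PP L Q (consts3 a b c)
  module A = Gadgets H a b c a≢b a≢c b≢c
  module B = Gadgets H b a c (≢-sym a≢b) b≢c a≢c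
  open A using (NearA; NearB; Domain)
  open Twin

  side : L → Bool
  side x = does (Q? x a b c)

  data Side (x : L) : Bool → Set where
    nearA : NearA x → Side x true
    nearB : NearB x → Side x false

  side-nearA : ∀ {x} → NearA x → side x ≡ true
  side-nearA {x} = dec-true (Q? x a b c)

  side-nearB : ∀ {x} → NearB x → side x ≡ false
  side-nearB {x} xB = dec-false (Q? x a b c) (λ xA → Q-exclusive xA xB)

  side-view : ∀ {x} → Domain x → Side x (side x)
  side-view {x} (inj₁ xA) = subst (Side x) (sym (side-nearA xA)) (nearA xA)
  side-view {x} (inj₂ xB) = subst (Side x) (sym (side-nearB xB)) (nearB xB)

  module _ {x : L} where
    true⇔nearA : ∀ {β} → Side x β → (β ≡ true) ⇔ NearA x
    true⇔nearA (nearA xA) = mk⇔ (λ _ → xA) (λ _ → refl)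
    true⇔nearA (nearB xB) = mk⇔ (λ ()) (λ xA → contradiction xB (Q-exclusive xA))

    false⇔nearB : ∀ {β} → Side x β → (β ≡ false) ⇔ NearB x
    false⇔nearB (nearA xA) = mk⇔ (λ ()) (λ xB → contradiction xB (Q-exclusive xA))
    false⇔nearB (nearB xB) = mk⇔ (λ _ → xB) (λ _ → refl)

  module _ {x y : L} where
    sameSide : ∀ {βx βy} → Side x βx → Side y βy → (βx ≡ βy) ⇔ ∃ (A.SameSideWitness x y)
    sameSide (nearA xA) (nearA yA) = mk⇔ (λ _ → A.sameSide-complete xA yA) (λ _ → refl)
    sameSide (nearB xB) (nearB yB) = mk⇔ (λ _ → swap (B.sameSide-complete yB xB)) (λ _ → refl)
      where
      swap : ∃ (B.SameSideWitness y x) → ∃ (A.SameSideWitness x y)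
      swap (u , ac∣uy , bc∣ux) = u , bc∣ux , ac∣uy
    sameSide (nearA xA) (nearB yB) = mk⇔ (λ ()) (λ (_ , w) → ⊥-elim (A.sameSide-sound xA yB w))
    sameSide (nearB xB) (nearA yA) = mk⇔ (λ ()) (λ (_ , bc∣ux , ac∣uy) →
      ⊥-elim (Q-exclusive (B.nearB-witness yA ac∣uy) (A.nearB-witness xB bc∣ux)))

  module _ {x y z : L} where
    NAE⇔notAllSame : ∀ {βx βy βz} → Side x βx → Side y βy → Side z βz →
                     NAE βx βy βz ⇔
                     (¬ (NearB x × NearB y × NearB z) × ¬ (NearA x × NearA y × NearA z))
    NAE⇔notAllSame sx sy sz =
      ¬-cong-⇔ (false⇔nearB sx ×-⇔ false⇔nearB sy ×-⇔ false⇔nearB sz) ×-⇔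
      ¬-cong-⇔ (true⇔nearA sx ×-⇔ true⇔nearA sy ×-⇔ true⇔nearA sz)

  ca cb cc : ∀ {V} → Term V
  ca = con zero
  cb = con (suc zero)
  cc = con (suc (suc zero))

  δ : Formula (Fin 1)
  δ = ppf 2 (Qa ca u₁ cb u₀ ∷ Qa ca x cc u₀ ∷ Qa cb x cc u₁ ∷ [])
    where
    x u₀ u₁ : Term (Fin 1 ⊎ Fin 2)
    x  = var (inj₁ zero)
    u₀ = var (inj₂ zero)
    u₁ = var (inj₂ (suc zero))

  Sat-δ⇔ : ∀ ρ → Sat δ ρ ⇔ ∃₂ (A.DomainWitness (ρ zero))
  Sat-δ⇔ ρ = mk⇔ (λ { (u , w₁ ∷ w₂ ∷ w₃ ∷ []) → u zero , u (suc zero) , w₁ , w₂ , w₃ })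
                 (λ { (u₀ , u₁ , w₁ , w₂ , w₃) →
                      (λ { zero → u₀ ; (suc zero) → u₁ }) , w₁ ∷ w₂ ∷ w₃ ∷ [] })

  Sat-δ⇒Domain : ∀ {ρ} → Sat δ ρ → Domain (ρ zero)
  Sat-δ⇒Domain {ρ} = A.domain-sound ∘ proj₂ ∘ proj₂ ∘ Equivalence.to (Sat-δ⇔ ρ)

  Domain⇒Sat-δ : ∀ {x} → Domain x → Sat δ (λ _ → x)
  Domain⇒Sat-δ (inj₁ xA) = Equivalence.from (Sat-δ⇔ _) (A.domain-complete xA)
  Domain⇒Sat-δ {x} (inj₂ xB) = Equivalence.from (Sat-δ⇔ _) (swap (B.domain-complete xB))
    where
    swap : ∃₂ (B.DomainWitness x) → ∃₂ (A.DomainWitness x)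
    swap (u₀ , u₁ , bu₁∣au₀ , bx∣cu₀ , ax∣cu₁) = u₁ , u₀ , Q-swap bu₁∣au₀ , ax∣cu₁ , bx∣cu₀

  φEq : Formula (Fin 2 × Fin 1)
  φEq = ppf 1 (Qa cb cc u x ∷ Qa ca cc u y ∷ [])
    where
    x y u : Term ((Fin 2 × Fin 1) ⊎ Fin 1)
    x = var (inj₁ (zero , zero))
    y = var (inj₁ (suc zero , zero))
    u = var (inj₂ zero)

  Sat-φEq⇔ : ∀ ρ → Sat φEq ρ ⇔ ∃ (A.SameSideWitness (ρ (zero , zero)) (ρ (suc zero , zero)))
  Sat-φEq⇔ ρ = mk⇔ (λ { (u , w₁ ∷ w₂ ∷ []) → u zero , w₁ , w₂ })
                   (λ { (u , w₁ , w₂) → (λ _ → u) , w₁ ∷ w₂ ∷ [] })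

  φR : Formula (Fin 3 × Fin 1)
  φR = ppf 4 (Qa ca x cc (u (# 1)) ∷ Qa ca y (u (# 0)) (u (# 1)) ∷ Qa ca z cb (u (# 0))
            ∷ Qa cb x cc (u (# 3)) ∷ Qa cb y (u (# 2)) (u (# 3)) ∷ Qa cb z ca (u (# 2)) ∷ [])
    where
    x y z : Term ((Fin 3 × Fin 1) ⊎ Fin 4)
    x = var (inj₁ (zero , zero))
    y = var (inj₁ (suc zero , zero))
    z = var (inj₁ (suc (suc zero) , zero))
    u : Fin 4 → Term ((Fin 3 × Fin 1) ⊎ Fin 4)
    u i = var (inj₂ i)

  Sat-φR⇔ : ∀ ρ → let x = ρ (zero , zero); y = ρ (suc zero , zero); z = ρ (suc (suc zero) , zero) in
            Sat φR ρ ⇔ (∃₂ (A.NotAllNearBWitness x y z) × ∃₂ (B.NotAllNearBWitness x y z))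
  Sat-φR⇔ ρ = mk⇔
    (λ { (u , w₁ ∷ w₂ ∷ w₃ ∷ w₄ ∷ w₅ ∷ w₆ ∷ []) →
         (u (# 0) , u (# 1) , w₁ , w₂ , w₃) , (u (# 2) , u (# 3) , w₄ , w₅ , w₆) })
    (λ { ((u₀ , u₁ , w₁ , w₂ , w₃) , (u₂ , u₃ , w₄ , w₅ , w₆)) →
         (λ { zero → u₀ ; (suc zero) → u₁ ; (suc (suc zero)) → u₂ ; (suc (suc (suc zero))) → u₃ })
         , w₁ ∷ w₂ ∷ w₃ ∷ w₄ ∷ w₅ ∷ w₆ ∷ [] })

  h : (Fin 1 → L) → Bool
  h ρ = side (ρ zero)

  h-surjective : ∀ β → Σ (Fin 1 → L) λ ρ → Sat δ ρ × h ρ ≡ β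
  h-surjective true = (λ _ → twin T) , Domain⇒Sat-δ (inj₁ xA) , side-nearA xA
    where
    T : Twin a (b ∷ c ∷ [])
    T = twinOf a _
    xA : NearA (twin T)
    xA = Q-swapˡ (twin-cherry T ∈₁ ∈₂ b≢c a≢b a≢c)
  h-surjective false = (λ _ → twin T) , Domain⇒Sat-δ (inj₂ xB) , side-nearB xB
    where
    T : Twin b (a ∷ c ∷ [])
    T = twinOf b _
    xB : NearB (twin T)
    xB = Q-swapˡ (twin-cherry T ∈₁ ∈₂ a≢c (≢-sym a≢b) b≢c)

  NAE⇔Sat-φR : ∀ (ρ : Fin 3 → Fin 1 → L) → (∀ i → Sat δ (ρ i)) →
               NAE (h (ρ zero)) (h (ρ (suc zero))) (h (ρ (suc (suc zero)))) ⇔ Sat φR (λ (i , j) → ρ i j)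
  NAE⇔Sat-φR ρ ρ∈δ =
    ⇔-sym (Sat-φR⇔ _) ⇔-∘
    ((A.notAllNearB dx dy dz ×-⇔ B.notAllNearB (Sum.swap dx) (Sum.swap dy) (Sum.swap dz)) ⇔-∘
     NAE⇔notAllSame (side-view dx) (side-view dy) (side-view dz))
    where
    dx : Domain (ρ zero zero)
    dx = Sat-δ⇒Domain (ρ∈δ zero)
    dy : Domain (ρ (suc zero) zero)
    dy = Sat-δ⇒Domain (ρ∈δ (suc zero))
    dz : Domain (ρ (suc (suc zero)) zero)
    dz = Sat-δ⇒Domain (ρ∈δ (suc (suc zero)))

  ≡⇔Sat-φEq : ∀ (ρ : Fin 2 → Fin 1 → L) → (∀ i → Sat δ (ρ i)) →
              (h (ρ zero) ≡ h (ρ (suc zero))) ⇔ Sat φEq (λ (i , j) → ρ i j)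
  ≡⇔Sat-φEq ρ ρ∈δ =
    ⇔-sym (Sat-φEq⇔ _) ⇔-∘
    sameSide (side-view (Sat-δ⇒Domain (ρ∈δ zero))) (side-view (Sat-δ⇒Domain (ρ∈δ (suc zero))))

  interpretation : PPInterpretation Bool NAE
  interpretation = record
    { d      = 1
    ; δ      = δ
    ; φR     = φR
    ; φEq    = φEq
    ; h      = h
    ; h-surj = h-surjective
    ; R-ok   = NAE⇔Sat-φR
    ; Eq-ok  = ≡⇔Sat-φEq
    }

mainTheorem2 : (L : Set) (C : L → L → L → Set) → IsHomBinBranchC L C →
    (a b c : L) → a ≢ b → a ≢ c → b ≢ c →
    PP.PPInterpretation L (Qd C) (consts3 a b c) Bool NAE
mainTheorem2 L C H a b c a≢b a≢c b≢c = Interpretation.interpretation H a b c a≢b a≢c b≢c
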